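{- Let $k$ be a positive even integer. In the maximum-cardinality online matching problem under edge arrivals with a hard budget of $k$ on the number of reassignments (defined in the context), the shortest-augmenting-path algorithm described in the context is $\left(1-\frac{2}{k+2}\right)$-competitive.
   Context: Problem. Let $G=(V,E)$ be a graph, not necessarily bipartite. The algorithm initially knows $V$ and $k$. Over $|E|$ timesteps the edges of $G$ arrive one at a time. At the end of each timestep the algorithm must output a matching in the current graph (with vertex set $V$ and the edges revealed so far), obtained from its previous matching (initially $\emptyset$) by at most $k$ (re)assignments, where the number of (re)assignments needed to go from matching $M_1$ to matching $M_2$ is the number of vertices incident to at least one edge of $M_1\triangle M_2$. Once a vertex is matched it must remain matched at all later timesteps. An algorithm is $\rho$-competitive if there is a constant $c\ge0$ such that on every instance the final matching has cardinality at least $\rho\cdot\mathsf{OPT}-c$, where $\mathsf{OPT}$ is the maximum cardinality of a matching in $G$. Algorithm. An augmenting path with respect to a matching $M$ is a path whose two endpoints are distinct vertices not covered by $M$ and whose edges alternate between non-$M$ and $M$ edges. When edge $e$ arrives, the algorithm finds a shortest augmenting path (with respect to the current matching, in the current graph) containing $e$; if no such path exists or its length (number of edges) exceeds $k-1$, it does nothing; otherwise it replaces the current matching $M$ by $M\triangle P$ for that path $P$. -}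

module Defs where

open import Data.Nat using (ℕ; zero; suc; _+_; _*_; _∸_; _≤_; _<_)
open import Data.Fin using (Fin)
open import Data.Bool using (Bool; true; false; not; if_then_else_)
open import Data.List using (List; []; _∷_; _++_; [_]; length)
open import Data.List.Membership.Propositional using (_∈_)
open import Data.List.Relation.Unary.All using (All)
open import Data.List.Relation.Unary.AllPairs using (AllPairs)
open import Data.List.Relation.Unary.Unique.Propositional using (Unique)
open import Data.Product using (_×_; _,_; Σ; ∃)
open import Data.Sum using (_⊎_)
open import Relation.Nullary using (¬_)
open import Relation.Binary.PropositionalEquality using (_≡_; _≢_)
open import Function.Bundles using (_⇔_)

Even : ℕ → Set
Even k = ∃ λ m → k ≡ m + m

-- Vertex set V = Fin n.  An edge is given as an (unordered) pair of vertices,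
-- represented by an ordered pair; orientation is irrelevant everywhere.
Edge : ℕ → Set
Edge n = Fin n × Fin n

Adj : {n : ℕ} → List (Edge n) → Fin n → Fin n → Set
Adj L u v = ((u , v) ∈ L) ⊎ ((v , u) ∈ L)

SameEdge : {n : ℕ} → Edge n → Edge n → Set
SameEdge (a , b) (c , d) = ((a ≡ c) × (b ≡ d)) ⊎ ((a ≡ d) × (b ≡ c))

SimpleSeq : {n : ℕ} → List (Edge n) → Set
SimpleSeq es = All (λ e → Data.Product.proj₁ e ≢ Data.Product.proj₂ e) es
             × AllPairs (λ e f → ¬ SameEdge e f) es

DisjointE : {n : ℕ} → Edge n → Edge n → Set
DisjointE (a , b) (c , d) = (a ≢ c) × (a ≢ d) × (b ≢ c) × (b ≢ d)

IsMatching : {n : ℕ} → List (Edge n) → List (Edge n) → Set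
IsMatching G M = AllPairs DisjointE M × All (λ e → Adj G (Data.Product.proj₁ e) (Data.Product.proj₂ e)) M

Free : {n : ℕ} → List (Edge n) → Fin n → Set
Free M v = ∀ w → ¬ Adj M v w

data Alt {n : ℕ} (G M : List (Edge n)) : Bool → List (Fin n) → Set where
  one  : ∀ {b} v → Alt G M b [ v ]
  cons : ∀ {b} u v vs → Adj G u v
       → (if b then ¬ Adj M u v else Adj M u v)
       → Alt G M (not b) (v ∷ vs) → Alt G M b (u ∷ v ∷ vs)

pathEdges : {n : ℕ} → List (Fin n) → List (Edge n)
pathEdges []           = []
pathEdges (v ∷ [])     = []
pathEdges (u ∷ v ∷ vs) = (u , v) ∷ pathEdges (v ∷ vs)

record AugPath {n : ℕ} (G M : List (Edge n)) : Set where
  field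
    start  : Fin n
    mid    : List (Fin n)
    end    : Fin n
  verts : List (Fin n)
  verts = start ∷ mid ++ [ end ]
  field
    distinct  : Unique verts
    alt       : Alt G M true verts
    startFree : Free M start
    endFree   : Free M end

pathLength : {n : ℕ} {G M : List (Edge n)} → AugPath G M → ℕ
pathLength P = length (pathEdges (AugPath.verts P))

Contains : {n : ℕ} {G M : List (Edge n)} → AugPath G M → Edge n → Set
Contains P (u , v) = Adj (pathEdges (AugPath.verts P)) u v

Xor : Set → Set → Set
Xor A B = (A × ¬ B) ⊎ (¬ A × B)

-- One timestep of the algorithm with budget k: edge e has arrived, G is the
-- current graph (already containing e), M the previous matching, M' the new one.
data Step {n : ℕ} (k : ℕ) (G M : List (Edge n)) (e : Edge n) : List (Edge n) → Set where
  keep    : (∀ (Q : AugPath G M) → Contains Q e → k ≤ pathLength Q)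
          → Step k G M e M
  augment : (P : AugPath G M) → Contains P e → pathLength P + 1 ≤ k
          → (∀ (Q : AugPath G M) → Contains Q e → pathLength P ≤ pathLength Q)
          → (M' : List (Edge n)) → IsMatching G M'
          → (∀ u v → Adj M' u v ⇔ Xor (Adj M u v) (Adj (pathEdges (AugPath.verts P)) u v))
          → Step k G M e M'

-- A run of the algorithm: from graph G (edges revealed so far) and matching M,
-- processing the remaining arrivals es ends with matching Mf.
data Run {n : ℕ} (k : ℕ) : List (Edge n) → List (Edge n) → List (Edge n) → List (Edge n) → Set where
  done : ∀ {G M} → Run k G M [] M
  step : ∀ {G M M' Mf e es} → Step k (e ∷ G) M e M' → Run k (e ∷ G) M' es Mf
       → Run k G M (e ∷ es) Mf

module Submission where

-- Invariant: after every arrival the current matching M has no augmenting path with fewer than k edges.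
-- It survives an augmentation along the shortest augmenting path P through the new edge e: for an
-- augmenting path Q of M′ = M ⊕ P, the matching M′ ⊕ Q has two edges more than M, so the symmetric
-- difference of M and M′ ⊕ Q contains two vertex-disjoint M-augmenting paths, built from vertices of
-- P and Q. At most one of them uses e, so their lengths add up to at least |P| + k and at most |P| + |Q|.
-- At the end, comparing M with a maximum matching M* in the same way gives at least |M*| − |M|
-- vertex-disjoint M-augmenting paths, each of odd length ≥ k and hence, k being even, with at least k
-- interior vertices, all covered by M; so k (|M*| − |M|) ≤ 2 |M|.

open import Defs
open import Algebra.Properties.CommutativeSemigroup using (interchange)
open import Data.Bool using (Bool; true; false; not; if_then_else_)
open import Data.Bool.Properties using (not-involutive)
open import Data.Empty using (⊥; ⊥-elim)
open import Data.Fin using (Fin; _≟_)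
open import Data.Fin.Properties using (any?; all?)
open import Data.List using (List; []; _∷_; _++_; [_]; _ʳ++_; length; filter; allFin; concat; map)
open import Data.List.Properties using (length-++; length-tabulate; ++-conicalʳ; ∷-injectiveʳ; ++-assoc)
open import Data.List.Membership.Propositional using (_∈_; _∉_)
open import Data.List.Membership.Propositional.Properties
  using (∈-∃++; ∈-++⁻; ∈-++⁺ˡ; ∈-++⁺ʳ; ∈-filter⁺; ∈-filter⁻; ∈-allFin)
import Data.List.Membership.DecPropositional as DecMembership
open import Data.List.Relation.Binary.Subset.Propositional using (_⊆_)
open import Data.List.Relation.Unary.Any using (here; there)
open import Data.List.Relation.Unary.All as All using (All; []; _∷_)
open import Data.List.Relation.Unary.All.Properties
  using (¬Any⇒All¬; All¬⇒¬Any; ++⁻ˡ) renaming (++⁺ to All-++⁺)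
open import Data.List.Relation.Unary.AllPairs as AllPairs using (AllPairs; []; _∷_)
open import Data.List.Relation.Unary.Unique.Propositional using (Unique)
open import Data.List.Relation.Unary.Unique.Propositional.Properties using (filter⁺; allFin⁺; ++⁺)
open import Data.Nat using (ℕ; zero; suc; _+_; _*_; _≤_; _<_; z≤n; s≤s)
open import Data.Nat.Properties
  using ( +-suc; +-comm; +-assoc; +-identityʳ; *-suc; *-zeroʳ; *-distribˡ-+; *-distribʳ-+; *-cancelˡ-≤
        ; suc-injective; ≤-refl; ≤-reflexive; ≤-trans; ≤-antisym; ≤-pred; <⇒≱; n≤0⇒n≡0
        ; m≤m+n; m<n+m; m+n≤o⇒m≤o; +-mono-≤; +-monoˡ-≤; +-monoʳ-≤; *-monoʳ-≤; +-cancelˡ-≤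
        ; +-commutativeSemigroup; module ≤-Reasoning)
open import Data.Product using (_×_; _,_; proj₁; proj₂; ∃; swap)
open import Data.Product.Properties using (≡-dec)
open import Data.Sum using (_⊎_; inj₁; inj₂; [_,_]′)
open import Function.Base using (_∘_; id)
open import Function.Bundles using (_⇔_; Equivalence)
open import Level using (Level; 0ℓ)
open import Relation.Binary.Core using (Rel)
open import Relation.Binary.Definitions using (Symmetric) renaming (Decidable to Decidable₂)
open import Relation.Binary.PropositionalEquality
  using (_≡_; _≢_; refl; sym; trans; cong; cong₂; subst; subst₂; module ≡-Reasoning)
open import Relation.Nullary using (¬_; yes; no; contradiction; _⊎-dec_; _×-dec_; ¬?)
open import Relation.Unary using (Pred; Decidable) renaming (_⊆_ to _⊆ᵖ_)
open import Relation.Unary.Properties using (_∩?_; ∁?)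

module _ {A : Set} where

  Unique-⊆⇒length≤ : ∀ {xs ys : List A} → Unique xs → xs ⊆ ys → length xs ≤ length ys
  Unique-⊆⇒length≤ {[]} _ _ = z≤n
  Unique-⊆⇒length≤ {x ∷ xs} {ys} (x∉xs ∷ u) x∷xs⊆ys
    with ps , qs , refl ← ∈-∃++ (x∷xs⊆ys (here refl)) =
    begin
      suc (length xs)              ≤⟨ s≤s (Unique-⊆⇒length≤ u xs⊆ps++qs) ⟩
      suc (length (ps ++ qs))      ≡⟨ cong suc (length-++ ps) ⟩
      suc (length ps + length qs)  ≡⟨ +-suc (length ps) (length qs) ⟨
      length ps + length (x ∷ qs)  ≡⟨ length-++ ps ⟨
      length (ps ++ x ∷ qs)        ∎
    where
    open ≤-Reasoning
    xs⊆ps++qs : xs ⊆ ps ++ qs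
    xs⊆ps++qs z∈xs with ∈-++⁻ ps (x∷xs⊆ys (there z∈xs))
    ... | inj₁ z∈ps         = ∈-++⁺ˡ z∈ps
    ... | inj₂ (here refl)  = contradiction refl (All.lookup x∉xs z∈xs)
    ... | inj₂ (there z∈qs) = ∈-++⁺ʳ ps z∈qs

  Unique-++⁻ˡ : ∀ xs {ys : List A} → Unique (xs ++ ys) → Unique xs
  Unique-++⁻ˡ []       _           = []
  Unique-++⁻ˡ (x ∷ xs) (x∉ ∷ uniq) = ++⁻ˡ xs x∉ ∷ Unique-++⁻ˡ xs uniq

  Unique-++⇒disjoint : ∀ xs {ys : List A} {x} → Unique (xs ++ ys) → x ∈ xs → x ∉ ys
  Unique-++⇒disjoint (x ∷ xs) (x∉ ∷ _)    (here refl) x∈ys = All¬⇒¬Any x∉ (∈-++⁺ʳ xs x∈ys)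
  Unique-++⇒disjoint (_ ∷ xs) (_ ∷ uniq)  (there x∈xs) = Unique-++⇒disjoint xs uniq x∈xs

  ∉-++⁻ : ∀ xs {ys : List A} {x} → x ∉ xs ++ ys → x ∉ xs × x ∉ ys
  ∉-++⁻ xs x∉ = x∉ ∘ ∈-++⁺ˡ , x∉ ∘ ∈-++⁺ʳ xs

  ∉-++⁺ : ∀ xs {ys : List A} {x} → x ∉ xs → x ∉ ys → x ∉ xs ++ ys
  ∉-++⁺ xs x∉xs x∉ys x∈ with ∈-++⁻ xs x∈
  ... | inj₁ x∈xs = x∉xs x∈xs
  ... | inj₂ x∈ys = x∉ys x∈ys

  ∈-ʳ++⁺ʳ : ∀ xs {ys : List A} {x} → x ∈ ys → x ∈ xs ʳ++ ys
  ∈-ʳ++⁺ʳ []       x∈ys = x∈ys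
  ∈-ʳ++⁺ʳ (y ∷ xs) x∈ys = ∈-ʳ++⁺ʳ xs (there x∈ys)

  ∈-ʳ++⁺ˡ : ∀ xs {ys : List A} {x} → x ∈ xs → x ∈ xs ʳ++ ys
  ∈-ʳ++⁺ˡ (y ∷ xs) (here refl)  = ∈-ʳ++⁺ʳ xs (here refl)
  ∈-ʳ++⁺ˡ (y ∷ xs) (there x∈xs) = ∈-ʳ++⁺ˡ xs x∈xs

  ∈-ʳ++⁻ : ∀ xs {ys : List A} {x} → x ∈ xs ʳ++ ys → x ∈ xs ⊎ x ∈ ys
  ∈-ʳ++⁻ []       x∈ = inj₂ x∈
  ∈-ʳ++⁻ (y ∷ xs) x∈ with ∈-ʳ++⁻ xs x∈
  ... | inj₁ x∈xs         = inj₁ (there x∈xs)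
  ... | inj₂ (here refl)  = inj₁ (here refl)
  ... | inj₂ (there x∈ys) = inj₂ x∈ys

  length-filter-split : ∀ {p q} {P : Pred A p} {Q : Pred A q} (P? : Decidable P) (Q? : Decidable Q) xs →
    length (filter P? xs) ≡ length (filter (P? ∩? Q?) xs) + length (filter (P? ∩? ∁? Q?) xs)
  length-filter-split P? Q? [] = refl
  length-filter-split P? Q? (x ∷ xs) with P? x | Q? x
  ... | yes _ | yes _ = cong suc (length-filter-split P? Q? xs)
  ... | yes _ | no _  = trans (cong suc (length-filter-split P? Q? xs)) (sym (+-suc _ _))
  ... | no _  | _     = length-filter-split P? Q? xs

double≤suc-double⇒≤ : ∀ h m → h + h ≤ suc (m + m) → h ≤ m
double≤suc-double⇒≤ zero    m       _        = z≤n
double≤suc-double⇒≤ (suc h) zero    (s≤s le) rewrite +-suc h h with le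
... | ()
double≤suc-double⇒≤ (suc h) (suc m) (s≤s le) rewrite +-suc h h | +-suc m m =
  s≤s (double≤suc-double⇒≤ h m (≤-pred le))

-- Counting vertices

private variable
  n : ℕ
  p q : Level
  P : Pred (Fin n) p
  Q : Pred (Fin n) q

Unique⇒length≤n : {xs : List (Fin n)} → Unique xs → length xs ≤ n
Unique⇒length≤n {n} {xs} unique =
  subst (length xs ≤_) (length-tabulate {n = n} (λ v → v)) (Unique-⊆⇒length≤ unique (λ {v} _ → ∈-allFin v))

count : ∀ {n p} {P : Pred (Fin n) p} → Decidable P → ℕ
count {n} P? = length (filter P? (allFin n))

count≤length : ∀ {n p} {P : Pred (Fin n) p} (P? : Decidable P) {ys : List (Fin n)} →
               P ⊆ᵖ (_∈ ys) → count P? ≤ length ys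
count≤length {n} P? P⊆ys =
  Unique-⊆⇒length≤ (filter⁺ P? (allFin⁺ n)) (P⊆ys ∘ proj₂ ∘ ∈-filter⁻ P? {xs = allFin n})

length≤count : (P? : Decidable P) {ys : List (Fin n)} → Unique ys → All P ys → length ys ≤ count P?
length≤count P? ys-unique Pys =
  Unique-⊆⇒length≤ ys-unique (λ {v} v∈ys → ∈-filter⁺ P? (∈-allFin v) (All.lookup Pys v∈ys))

count-mono : (P? : Decidable P) (Q? : Decidable Q) → P ⊆ᵖ Q → count P? ≤ count Q?
count-mono P? Q? P⊆Q = count≤length P? (λ {v} Pv → ∈-filter⁺ Q? (∈-allFin v) (P⊆Q Pv))

count-split : ∀ {n p q} {P : Pred (Fin n) p} {Q : Pred (Fin n) q} (P? : Decidable P) (Q? : Decidable Q) →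
              count P? ≡ count (P? ∩? Q?) + count (P? ∩? ∁? Q?)
count-split {n} P? Q? = length-filter-split P? Q? (allFin n)

count≤n : ∀ {n p} {P : Pred (Fin n) p} (P? : Decidable P) → count P? ≤ n
count≤n {n} P? = Unique⇒length≤n (filter⁺ P? (allFin⁺ n))

∈-dec : (xs : List (Fin n)) → Decidable (_∈ xs)
∈-dec xs x = x ∈? xs
  where open DecMembership _≟_ using (_∈?_)

∉-dec : (xs : List (Fin n)) → Decidable (_∉ xs)
∉-dec xs = ∁? (∈-dec xs)

count-∉-++ : (P? : Decidable P) (W R : List (Fin n)) →
  count (P? ∩? ∉-dec R) ≡ count ((P? ∩? ∉-dec R) ∩? ∈-dec W) + count (P? ∩? ∉-dec (W ++ R))
count-∉-++ P? W R =
  trans (count-split (P? ∩? ∉-dec R) (∈-dec W)) (cong (count ((P? ∩? ∉-dec R) ∩? ∈-dec W) +_)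
  (≤-antisym (count-mono ((P? ∩? ∉-dec R) ∩? ∁? (∈-dec W)) (P? ∩? ∉-dec (W ++ R))
               (λ ((Pv , v∉R) , v∉W) → Pv , ∉-++⁺ W v∉W v∉R))
             (count-mono (P? ∩? ∉-dec (W ++ R)) ((P? ∩? ∉-dec R) ∩? ∁? (∈-dec W))
               (λ (Pv , v∉W++R) → let v∉W , v∉R = ∉-++⁻ W v∉W++R in (Pv , v∉R) , v∉W))))

-- Adjacency and matchings

private variable
  u v w x y a b : Fin n
  L G M : List (Edge n)
  bit : Bool

¬Adj[] : ¬ Adj {n} [] u v
¬Adj[] (inj₁ ())
¬Adj[] (inj₂ ())

Adj-sym : Adj L u v → Adj L v u
Adj-sym (inj₁ uv∈L) = inj₂ uv∈L
Adj-sym (inj₂ vu∈L) = inj₁ vu∈L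

Adj-head : Adj ((u , v) ∷ L) u v
Adj-head = inj₁ (here refl)

Adj-mono : ∀ {L′} → L ⊆ L′ → Adj L u v → Adj L′ u v
Adj-mono L⊆L′ (inj₁ uv∈L) = inj₁ (L⊆L′ uv∈L)
Adj-mono L⊆L′ (inj₂ vu∈L) = inj₂ (L⊆L′ vu∈L)

Adj-∷⁺ : ∀ {e} → Adj L u v → Adj (e ∷ L) u v
Adj-∷⁺ = Adj-mono there

Adj-∷⁻ : ∀ {e} → Adj (e ∷ L) u v → SameEdge (u , v) e ⊎ Adj L u v
Adj-∷⁻ (inj₁ (here refl))     = inj₁ (inj₁ (refl , refl))
Adj-∷⁻ (inj₂ (here refl))     = inj₁ (inj₂ (refl , refl))
Adj-∷⁻ (inj₁ (there uv∈L))    = inj₂ (inj₁ uv∈L)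
Adj-∷⁻ (inj₂ (there vu∈L))    = inj₂ (inj₂ vu∈L)

SameEdge-sym : SameEdge (u , v) (a , b) → SameEdge (a , b) (u , v)
SameEdge-sym (inj₁ (refl , refl)) = inj₁ (refl , refl)
SameEdge-sym (inj₂ (refl , refl)) = inj₂ (refl , refl)

Adj-SameEdge : SameEdge (u , v) (a , b) → Adj L u v → Adj L a b
Adj-SameEdge (inj₁ (refl , refl)) = λ uv → uv
Adj-SameEdge (inj₂ (refl , refl)) = Adj-sym

SameEdge-functional : SameEdge (u , v) (a , b) → SameEdge (u , w) (a , b) → v ≡ w
SameEdge-functional (inj₁ (refl , refl)) (inj₁ (refl , refl)) = refl
SameEdge-functional (inj₁ (refl , refl)) (inj₂ (refl , refl)) = refl
SameEdge-functional (inj₂ (refl , refl)) (inj₁ (refl , refl)) = refl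
SameEdge-functional (inj₂ (refl , refl)) (inj₂ (refl , refl)) = refl

Adj? : (L : List (Edge n)) → Decidable₂ (Adj L)
Adj? L u v = ((u , v) ∈? L) ⊎-dec ((v , u) ∈? L)
  where open DecMembership (≡-dec _≟_ _≟_) using (_∈?_)

LoopFree : List (Edge n) → Set
LoopFree G = ∀ {u} → ¬ Adj G u u

nonLoops⇒LoopFree : All (λ e → proj₁ e ≢ proj₂ e) G → LoopFree G
nonLoops⇒LoopFree nonLoop (inj₁ uu∈G) = All.lookup nonLoop uu∈G refl
nonLoops⇒LoopFree nonLoop (inj₂ uu∈G) = All.lookup nonLoop uu∈G refl

Functional : Rel (Fin n) 0ℓ → Set
Functional R = ∀ {u v w} → R u v → R u w → v ≡ w

record IsMatchingRel (R : Rel (Fin n) 0ℓ) : Set where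
  field
    decidable  : Decidable₂ R
    symmetric  : Symmetric R
    functional : Functional R
    irreflexive : ∀ {u} → ¬ R u u

Covered : Rel (Fin n) 0ℓ → Pred (Fin n) 0ℓ
Covered R u = ∃ (R u)

Covered? : {R : Rel (Fin n) 0ℓ} → Decidable₂ R → Decidable (Covered R)
Covered? R? u = any? (R? u)

_⊕_ : Rel (Fin n) 0ℓ → Rel (Fin n) 0ℓ → Rel (Fin n) 0ℓ
(R ⊕ S) u v = Xor (R u v) (S u v)

⊕-decidable : {R S : Rel (Fin n) 0ℓ} → Decidable₂ R → Decidable₂ S → Decidable₂ (R ⊕ S)
⊕-decidable R? S? u v = ((R? u v) ×-dec ¬? (S? u v)) ⊎-dec (¬? (R? u v) ×-dec (S? u v))

⊕-symmetric : {R S : Rel (Fin n) 0ℓ} → Symmetric R → Symmetric S → Symmetric (R ⊕ S)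
⊕-symmetric R-sym S-sym (inj₁ (Ruv , ¬Suv)) = inj₁ (R-sym Ruv , ¬Suv ∘ S-sym)
⊕-symmetric R-sym S-sym (inj₂ (¬Ruv , Suv)) = inj₂ (¬Ruv ∘ R-sym , S-sym Suv)

endpoints : List (Edge n) → List (Fin n)
endpoints []            = []
endpoints ((a , b) ∷ L) = a ∷ b ∷ endpoints L

length-endpoints : (L : List (Edge n)) → length (endpoints L) ≡ 2 * length L
length-endpoints []            = refl
length-endpoints ((a , b) ∷ L) = trans (cong (suc ∘ suc) (length-endpoints L)) (sym (*-suc 2 (length L)))

Adj⇒∈endpoints : Adj L u v → u ∈ endpoints L
Adj⇒∈endpoints {L = []} uv = ⊥-elim (¬Adj[] uv)
Adj⇒∈endpoints {L = (a , b) ∷ L} uv with Adj-∷⁻ uv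
... | inj₁ (inj₁ (refl , _)) = here refl
... | inj₁ (inj₂ (refl , _)) = there (here refl)
... | inj₂ uv∈L              = there (there (Adj⇒∈endpoints uv∈L))

∈endpoints⇒Covered : u ∈ endpoints L → Covered (Adj L) u
∈endpoints⇒Covered {L = (a , b) ∷ L} (here refl)         = b , Adj-head
∈endpoints⇒Covered {L = (a , b) ∷ L} (there (here refl)) = a , Adj-sym Adj-head
∈endpoints⇒Covered {L = (a , b) ∷ L} (there (there u∈L)) =
  let w , uw = ∈endpoints⇒Covered u∈L in w , Adj-∷⁺ uw

All-DisjointE⇒≢endpoints : All (DisjointE (a , b)) L → u ∈ endpoints L → a ≢ u × b ≢ u
All-DisjointE⇒≢endpoints {L = (c , d) ∷ L} ((a≢c , a≢d , b≢c , b≢d) ∷ _) (here refl)         = a≢c , b≢c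
All-DisjointE⇒≢endpoints {L = (c , d) ∷ L} ((a≢c , a≢d , b≢c , b≢d) ∷ _) (there (here refl)) = a≢d , b≢d
All-DisjointE⇒≢endpoints {L = (c , d) ∷ L} (_ ∷ disj) (there (there u∈L)) = All-DisjointE⇒≢endpoints disj u∈L

SameEdge-∉endpoints : All (DisjointE (a , b)) L → SameEdge (u , v) (a , b) → u ∉ endpoints L
SameEdge-∉endpoints disj (inj₁ (refl , _)) u∈L = proj₁ (All-DisjointE⇒≢endpoints disj u∈L) refl
SameEdge-∉endpoints disj (inj₂ (refl , _)) u∈L = proj₂ (All-DisjointE⇒≢endpoints disj u∈L) refl

matching-functional : AllPairs DisjointE M → Functional (Adj M)
matching-functional {M = []} _ uv _ = ⊥-elim (¬Adj[] uv)
matching-functional {M = (a , b) ∷ M} (disj ∷ disjs) uv uw with Adj-∷⁻ uv | Adj-∷⁻ uw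
... | inj₁ uv≈ab | inj₁ uw≈ab = SameEdge-functional uv≈ab uw≈ab
... | inj₁ uv≈ab | inj₂ uw∈M  = ⊥-elim (SameEdge-∉endpoints disj uv≈ab (Adj⇒∈endpoints uw∈M))
... | inj₂ uv∈M  | inj₁ uw≈ab = ⊥-elim (SameEdge-∉endpoints disj uw≈ab (Adj⇒∈endpoints uv∈M))
... | inj₂ uv∈M  | inj₂ uw∈M  = matching-functional disjs uv∈M uw∈M

matching⊆graph : IsMatching G M → Adj M u v → Adj G u v
matching⊆graph (_ , M⊆G) (inj₁ uv∈M) = All.lookup M⊆G uv∈M
matching⊆graph (_ , M⊆G) (inj₂ vu∈M) = Adj-sym (All.lookup M⊆G vu∈M)

endpoints-unique : LoopFree G → IsMatching G M → Unique (endpoints M)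
endpoints-unique {M = []} _ _ = []
endpoints-unique {M = (a , b) ∷ M} loopFree (disj ∷ disjs , ab∈G ∷ M⊆G) =
  (a≢b ∷ All.tabulate (proj₁ ∘ All-DisjointE⇒≢endpoints disj))
  ∷ All.tabulate (proj₂ ∘ All-DisjointE⇒≢endpoints disj)
  ∷ endpoints-unique loopFree (disjs , M⊆G)
  where
  a≢b : a ≢ b
  a≢b refl = loopFree ab∈G

IsMatching-mono : ∀ {G′} → G ⊆ G′ → IsMatching G M → IsMatching G′ M
IsMatching-mono G⊆G′ (disjoint , M⊆G) = disjoint , All.map (Adj-mono G⊆G′) M⊆G

Adj-isMatchingRel : LoopFree G → IsMatching G M → IsMatchingRel (Adj M)
Adj-isMatchingRel {M = M} loopFree isMatching = record
  { decidable   = Adj? M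
  ; symmetric   = Adj-sym
  ; functional  = matching-functional (proj₁ isMatching)
  ; irreflexive = loopFree ∘ matching⊆graph isMatching
  }

count-covered≤ : (L : List (Edge n)) → count (Covered? (Adj? L)) ≤ 2 * length L
count-covered≤ L = subst (count (Covered? (Adj? L)) ≤_) (length-endpoints L)
                         (count≤length (Covered? (Adj? L)) (Adj⇒∈endpoints ∘ proj₂))

matching-count-covered : LoopFree G → IsMatching G M → 2 * length M ≤ count (Covered? (Adj? M))
matching-count-covered {M = M} loopFree isMatching =
  subst (_≤ count (Covered? (Adj? M))) (length-endpoints M)
        (length≤count (Covered? (Adj? M)) (endpoints-unique loopFree isMatching) (All.tabulate ∈endpoints⇒Covered))

-- Alternating and augmenting paths

PathAdj : List (Fin n) → Rel (Fin n) 0ℓ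
PathAdj vs = Adj (pathEdges vs)

PathAdj⇒∈ : ∀ vs → PathAdj vs x y → x ∈ vs
PathAdj⇒∈ []           xy = ⊥-elim (¬Adj[] xy)
PathAdj⇒∈ (v ∷ [])     xy = ⊥-elim (¬Adj[] xy)
PathAdj⇒∈ (u ∷ v ∷ vs) (inj₁ (here refl)) = here refl
PathAdj⇒∈ (u ∷ v ∷ vs) (inj₂ (here refl)) = there (here refl)
PathAdj⇒∈ (u ∷ v ∷ vs) (inj₁ (there xy))  = there (PathAdj⇒∈ (v ∷ vs) (inj₁ xy))
PathAdj⇒∈ (u ∷ v ∷ vs) (inj₂ (there yx))  = there (PathAdj⇒∈ (v ∷ vs) (inj₂ yx))

length-pathEdges : ∀ (x : Fin n) xs → length (pathEdges (x ∷ xs)) ≡ length xs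
length-pathEdges x []       = refl
length-pathEdges x (y ∷ xs) = cong suc (length-pathEdges y xs)

Alt⇒graph : ∀ {vs} → Alt G M bit vs → PathAdj vs x y → Adj G x y
Alt⇒graph (one v) xy = ⊥-elim (¬Adj[] xy)
Alt⇒graph (cons u v vs uv _ alt) xy with Adj-∷⁻ xy
... | inj₁ xy≈uv  = Adj-SameEdge (SameEdge-sym xy≈uv) uv
... | inj₂ xy∈tail = Alt⇒graph alt xy∈tail

Alt-regraph : ∀ {G′ vs} → (∀ {x y} → PathAdj vs x y → Adj G′ x y) → Alt G M bit vs → Alt G′ M bit vs
Alt-regraph path⊆G′ (one v)               = one v
Alt-regraph path⊆G′ (cons u v vs _ c alt) =
  cons u v vs (path⊆G′ Adj-head) c (Alt-regraph (path⊆G′ ∘ Adj-∷⁺) alt)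

LastFree : List (Edge n) → Fin n → List (Fin n) → Set
LastFree M v []       = Free M v
LastFree M _ (v ∷ vs) = LastFree M v vs

LastFree-++ : ∀ (u : Fin n) mid {z} → Free M z → LastFree M u (mid ++ [ z ])
LastFree-++ u []      z-free = z-free
LastFree-++ u (v ∷ mid) z-free = LastFree-++ v mid z-free

Alt-nonMatching-edge : ∀ {rest} → Alt G M bit (u ∷ rest) → LastFree M u rest → w ∈ u ∷ rest →
  (∃ λ y → PathAdj (u ∷ rest) w y × ¬ Adj M w y) ⊎ (w ≡ u × (bit ≡ false ⊎ rest ≡ []))
Alt-nonMatching-edge (one v) _ (here refl) = inj₂ (refl , inj₂ refl)
Alt-nonMatching-edge {bit = true}  (cons u v vs _ ¬uv _) _ (here refl) = inj₁ (v , Adj-head , ¬uv)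
Alt-nonMatching-edge {bit = false} (cons u v vs _ _ _)   _ (here refl) = inj₂ (refl , inj₁ refl)
Alt-nonMatching-edge {bit = true} (cons u v vs _ ¬uv alt) free (there w∈tail)
  with Alt-nonMatching-edge alt free w∈tail
... | inj₁ (y , wy , ¬wy)     = inj₁ (y , Adj-∷⁺ wy , ¬wy)
... | inj₂ (refl , _)         = inj₁ (u , Adj-sym Adj-head , ¬uv ∘ Adj-sym)
Alt-nonMatching-edge {bit = false} (cons u v vs _ _ alt) free (there w∈tail)
  with Alt-nonMatching-edge alt free w∈tail
... | inj₁ (y , wy , ¬wy)     = inj₁ (y , Adj-∷⁺ wy , ¬wy)
... | inj₂ (refl , inj₂ refl) = inj₁ (u , Adj-sym Adj-head , free u)

Alt-matching-on-path : ∀ {rest} → Functional (Adj M) → Alt G M bit (u ∷ rest) → LastFree M u rest →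
  w ∈ u ∷ rest → Adj M w x → PathAdj (u ∷ rest) w x ⊎ (w ≡ u × bit ≡ true)
Alt-matching-on-path fun (one v) v-free (here refl) vx = ⊥-elim (v-free _ vx)
Alt-matching-on-path {bit = true}  fun (cons u v vs _ _ _) _ (here refl) _ = inj₂ (refl , refl)
Alt-matching-on-path {bit = false} fun (cons u v vs _ uv _) _ (here refl) ux =
  inj₁ (subst (PathAdj (u ∷ v ∷ vs) u) (fun uv ux) Adj-head)
Alt-matching-on-path {bit = true} fun (cons u v vs _ _ alt) free (there w∈tail) wx
  with Alt-matching-on-path fun alt free w∈tail wx
... | inj₁ wx-on-tail = inj₁ (Adj-∷⁺ wx-on-tail)
Alt-matching-on-path {bit = false} fun (cons u v vs _ uv alt) free (there w∈tail) wx
  with Alt-matching-on-path fun alt free w∈tail wx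
... | inj₁ wx-on-tail = inj₁ (Adj-∷⁺ wx-on-tail)
... | inj₂ (refl , _) = inj₁ (subst (PathAdj (u ∷ v ∷ vs) v) (fun (Adj-sym uv) wx) (Adj-sym Adj-head))

Alt-false⇒head-matching : ∀ {vs} → Alt G M false (w ∷ vs) → Unique (w ∷ vs) → PathAdj (w ∷ vs) w y → Adj M w y
Alt-false⇒head-matching (one _) _ wy = ⊥-elim (¬Adj[] wy)
Alt-false⇒head-matching (cons w v vs _ wv _) (w∉ ∷ _) wy with Adj-∷⁻ wy
... | inj₁ (inj₁ (_ , refl))  = wv
... | inj₁ (inj₂ (refl , _))  = ⊥-elim (All.head w∉ refl)
... | inj₂ wy∈tail            = ⊥-elim (All¬⇒¬Any w∉ (PathAdj⇒∈ (v ∷ vs) wy∈tail))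

¬nonMatching-head-and-tail : ∀ {vs} → (if bit then ¬ Adj M u v else Adj M u v) → Alt G M (not bit) (v ∷ vs) →
  Unique (u ∷ v ∷ vs) → SameEdge (w , x) (u , v) → PathAdj (v ∷ vs) w y → ¬ Adj M w x → ¬ Adj M w y → ⊥
¬nonMatching-head-and-tail _ _ (u∉ ∷ _) (inj₁ (refl , _)) uy _ _ = All¬⇒¬Any u∉ (PathAdj⇒∈ _ uy)
¬nonMatching-head-and-tail {bit = false} uv _ _ (inj₂ (refl , refl)) _ ¬vu _ = ¬vu (Adj-sym uv)
¬nonMatching-head-and-tail {bit = true} _ alt (_ ∷ unique) (inj₂ (refl , refl)) vy _ ¬vy =
  ¬vy (Alt-false⇒head-matching alt unique vy)

Alt-nonMatching-functional : ∀ {vs} → Alt G M bit vs → Unique vs → PathAdj vs w x → PathAdj vs w y →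
  ¬ Adj M w x → ¬ Adj M w y → x ≡ y
Alt-nonMatching-functional (one _) _ wx = ⊥-elim (¬Adj[] wx)
Alt-nonMatching-functional (cons u v vs _ c alt) unique wx wy ¬wx ¬wy with Adj-∷⁻ wx | Adj-∷⁻ wy
... | inj₁ wx≈uv   | inj₁ wy≈uv   = SameEdge-functional wx≈uv wy≈uv
... | inj₁ wx≈uv   | inj₂ wy∈tail = ⊥-elim (¬nonMatching-head-and-tail c alt unique wx≈uv wy∈tail ¬wx ¬wy)
... | inj₂ wx∈tail | inj₁ wy≈uv   = ⊥-elim (¬nonMatching-head-and-tail c alt unique wy≈uv wx∈tail ¬wy ¬wx)
... | inj₂ wx∈tail | inj₂ wy∈tail = Alt-nonMatching-functional alt (AllPairs.tail unique) wx∈tail wy∈tail ¬wx ¬wy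

length-verts : (P : AugPath G M) → length (AugPath.verts P) ≡ suc (pathLength P)
length-verts P = cong suc (sym (length-pathEdges start (mid ++ [ end ])))
  where open AugPath P

pathLength≡suc-mid : (P : AugPath G M) → pathLength P ≡ suc (length (AugPath.mid P))
pathLength≡suc-mid P = begin
  length (pathEdges (start ∷ mid ++ [ end ])) ≡⟨ length-pathEdges start (mid ++ [ end ]) ⟩
  length (mid ++ [ end ])                     ≡⟨ length-++ mid ⟩
  length mid + 1                              ≡⟨ +-comm (length mid) 1 ⟩
  suc (length mid)                            ∎
  where
  open AugPath P
  open ≡-Reasoning

no-augPath-in-empty : (Q : AugPath [] M) → ⊥
no-augPath-in-empty Q with AugPath.mid Q | AugPath.alt Q
... | []    | cons _ _ _ edge _ _ = ¬Adj[] edge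
... | _ ∷ _ | cons _ _ _ edge _ _ = ¬Adj[] edge

LongAugPaths : ℕ → List (Edge n) → List (Edge n) → Set
LongAugPaths k G M = ∀ (Q : AugPath G M) → k ≤ pathLength Q

AugPath-regraph : ∀ {G′} (Q : AugPath G M) → (∀ {x y} → PathAdj (AugPath.verts Q) x y → Adj G′ x y) →
                  AugPath G′ M
AugPath-regraph Q path⊆G′ = record
  { start     = start
  ; mid       = mid
  ; end       = end
  ; distinct  = distinct
  ; alt       = Alt-regraph path⊆G′ alt
  ; startFree = startFree
  ; endFree   = endFree
  }
  where open AugPath Q

through-or-long : ∀ {k} → LongAugPaths k G M → (Q : AugPath ((a , b) ∷ G) M) →
                  Contains Q (a , b) ⊎ k ≤ pathLength Q
through-or-long {G = G} {a = a} {b = b} long Q with Adj? (pathEdges (AugPath.verts Q)) a b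
... | yes Q∋ab = inj₁ Q∋ab
... | no ¬Q∋ab = inj₂ (long (AugPath-regraph Q on-G))
  where
  on-G : ∀ {x y} → PathAdj (AugPath.verts Q) x y → Adj G x y
  on-G xy with Adj-∷⁻ (Alt⇒graph (AugPath.alt Q) xy)
  ... | inj₁ xy≈ab = ⊥-elim (¬Q∋ab (Adj-SameEdge xy≈ab xy))
  ... | inj₂ xy∈G  = xy∈G

module AugmentingPath {G M : List (Edge n)} (M-matching : IsMatchingRel (Adj M)) (P : AugPath G M) where
  open AugPath P public
  open IsMatchingRel M-matching using () renaming (functional to fun)

  end∈verts : end ∈ verts
  end∈verts = there (∈-++⁺ʳ mid (here refl))

  start≢end : start ≢ end
  start≢end refl = All.lookup (AllPairs.head distinct) (∈-++⁺ʳ mid (here refl)) refl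

  private
    lastFree : LastFree M start (mid ++ [ end ])
    lastFree = LastFree-++ start mid endFree

  nonMatching-edge : w ∈ verts → ∃ λ y → PathAdj verts w y × ¬ Adj M w y
  nonMatching-edge w∈P with Alt-nonMatching-edge alt lastFree w∈P
  ... | inj₁ edge                  = edge
  ... | inj₂ (_ , inj₂ mid++end≡[]) = contradiction (++-conicalʳ mid [ end ] mid++end≡[]) λ ()

  matching-on-path : w ∈ verts → Adj M w x → PathAdj verts w x
  matching-on-path w∈P wx with Alt-matching-on-path fun alt lastFree w∈P wx
  ... | inj₁ wx-on-path = wx-on-path
  ... | inj₂ (refl , _) = ⊥-elim (startFree _ wx)

  Augmented : Rel (Fin n) 0ℓ
  Augmented = Adj M ⊕ PathAdj verts

  augmented-functional : Functional Augmented
  augmented-functional (inj₁ (vx , _)) (inj₁ (vy , _)) = fun vx vy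
  augmented-functional (inj₁ (vx , ¬vx-on-P)) (inj₂ (_ , vy-on-P)) =
    ⊥-elim (¬vx-on-P (matching-on-path (PathAdj⇒∈ verts vy-on-P) vx))
  augmented-functional (inj₂ (_ , vx-on-P)) (inj₁ (vy , ¬vy-on-P)) =
    ⊥-elim (¬vy-on-P (matching-on-path (PathAdj⇒∈ verts vx-on-P) vy))
  augmented-functional (inj₂ (¬vx , vx-on-P)) (inj₂ (¬vy , vy-on-P)) =
    Alt-nonMatching-functional alt distinct vx-on-P vy-on-P ¬vx ¬vy

  augmented-covers-path : w ∈ verts → Covered Augmented w
  augmented-covers-path w∈P = let y , wy-on-P , ¬wy = nonMatching-edge w∈P in y , inj₂ (¬wy , wy-on-P)

  augmented-covers-matched : Adj M w x → Covered Augmented w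
  augmented-covers-matched {w = w} {x = x} wx with Adj? (pathEdges verts) w x
  ... | yes wx-on-P = augmented-covers-path (PathAdj⇒∈ verts wx-on-P)
  ... | no ¬wx-on-P = x , inj₁ (wx , ¬wx-on-P)

  augmented-isMatchingRel : LoopFree G → IsMatchingRel Augmented
  augmented-isMatchingRel loopFree = record
    { decidable   = ⊕-decidable (Adj? M) (Adj? (pathEdges verts))
    ; symmetric   = ⊕-symmetric {R = Adj M} {S = PathAdj verts} Adj-sym Adj-sym
    ; functional  = augmented-functional
    ; irreflexive = irreflexive
    }
    where
    irreflexive : ¬ Augmented u u
    irreflexive (inj₁ (uu , _))       = IsMatchingRel.irreflexive M-matching uu
    irreflexive (inj₂ (_ , uu-on-P)) = loopFree (Alt⇒graph alt uu-on-P)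

-- The symmetric difference of two matchings

module SymmetricDifference {M : List (Edge n)} {N : Rel (Fin n) 0ℓ}
  (M-matching : IsMatchingRel (Adj M)) (N-matching : IsMatchingRel N) where

  private
    V = Fin n
    module M = IsMatchingRel M-matching
    module N = IsMatchingRel N-matching

  Δ : Bool → Rel V 0ℓ
  Δ true  u v = N u v × ¬ Adj M u v
  Δ false u v = Adj M u v × ¬ N u v

  Δ? : ∀ b → Decidable₂ (Δ b)
  Δ? true  u v = N.decidable u v ×-dec ¬? (M.decidable u v)
  Δ? false u v = M.decidable u v ×-dec ¬? (N.decidable u v)

  Δ-sym : ∀ b → Symmetric (Δ b)
  Δ-sym true  (uv , ¬uv) = N.symmetric uv , ¬uv ∘ Adj-sym
  Δ-sym false (uv , ¬uv) = Adj-sym uv , ¬uv ∘ N.symmetric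

  Δ-functional : ∀ b → Functional (Δ b)
  Δ-functional true  (uv , _) (uw , _) = N.functional uv uw
  Δ-functional false (uv , _) (uw , _) = M.functional uv uw

  Δ-irreflexive : ∀ b → ¬ Δ b u u
  Δ-irreflexive true  = N.irreflexive ∘ proj₁
  Δ-irreflexive false = M.irreflexive ∘ proj₁

  Δ-disjoint : ∀ b → Δ b u v → ¬ Δ (not b) u v
  Δ-disjoint true  (_ , ¬Muv) (Muv , _) = ¬Muv Muv
  Δ-disjoint false (_ , ¬Nuv) (Nuv , _) = ¬Nuv Nuv

  Source Sink : Pred V 0ℓ
  Source v = (∀ w → ¬ Δ false v w) × ∃ (Δ true v)
  Sink   v = (∀ w → ¬ Δ true v w) × ∃ (Δ false v)

  Source? : Decidable Source
  Source? v = all? (λ w → ¬? (Δ? false v w)) ×-dec any? (Δ? true v)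

  Sink? : Decidable Sink
  Sink? v = all? (λ w → ¬? (Δ? true v w)) ×-dec any? (Δ? false v)

  Source⇒free : Source v → Free M v
  Source⇒free {v} (no-false , y , vy , ¬Mvy) w Mvw with N.decidable v w
  ... | yes vw = ¬Mvy (subst (Adj M v) (N.functional vw vy) Mvw)
  ... | no ¬vw = no-false w (Mvw , ¬vw)

  free⇒Source : Free M v → N v y → Source v
  free⇒Source {y = y} v-free vy = (λ w → v-free w ∘ proj₁) , y , vy , v-free y

  Sink⇒N-free : Sink v → ¬ N v y
  Sink⇒N-free {v} {y} (no-true , w , Mvw , ¬vw) vy with M.decidable v y
  ... | yes Mvy = ¬vw (subst (N v) (M.functional Mvy Mvw) vy)
  ... | no ¬Mvy = no-true y (vy , ¬Mvy)

  data Alternating : Bool → List V → Set where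
    one  : ∀ {b} v → Alternating b [ v ]
    cons : ∀ {b} u v vs → Δ b u v → Alternating (not b) (v ∷ vs) → Alternating b (u ∷ v ∷ vs)

  Alternating-∷ : ∀ {b vs} → Δ b u v → Alternating (not b) (v ∷ vs) → Alternating (not (not b)) (u ∷ v ∷ vs)
  Alternating-∷ {b = true}  uv alt = cons _ _ _ uv alt
  Alternating-∷ {b = false} uv alt = cons _ _ _ uv alt

  record Component : Set where
    field
      start end   : V
      mid         : List V
      half        : ℕ
      distinct    : Unique (start ∷ mid ++ [ end ])
      alternating : Alternating true (start ∷ mid ++ [ end ])
      start-source : Source start
      end-source   : Source end
      mid-even     : length mid ≡ half + half
      mid-matched  : ∀ {x} → x ∈ mid → ∃ (Δ false x)
    verts : List V
    verts = start ∷ mid ++ [ end ]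

  Closed : List V → Set
  Closed R = ∀ {b x y} → x ∉ R → Δ b x y → y ∉ R

  -- Every source outside R ends either one of the components or a path of M ⊕ N that stops at a sink.
  record Decomposition (R : List V) : Set where
    open Component
    field
      components         : List Component
      disjoint           : Unique (concat (map verts components))
      interiors-disjoint : Unique (concat (map mid components))
      avoids             : ∀ {x} → x ∈ concat (map verts components) → x ∉ R
      interiors⊆verts    : concat (map mid components) ⊆ concat (map verts components)
      sources≤           : count (Source? ∩? ∉-dec R) ≤ 2 * length components + count (Sink? ∩? ∉-dec R)

  sources≤-++ : ∀ {R} W k p →
    count ((Source? ∩? ∉-dec R) ∩? ∈-dec W) ≤ k + count ((Sink? ∩? ∉-dec R) ∩? ∈-dec W) →
    count (Source? ∩? ∉-dec (W ++ R)) ≤ 2 * p + count (Sink? ∩? ∉-dec (W ++ R)) →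
    count (Source? ∩? ∉-dec R) ≤ k + 2 * p + count (Sink? ∩? ∉-dec R)
  sources≤-++ {R} W k p on-W off-W = begin
    count (Source? ∩? ∉-dec R)            ≡⟨ count-∉-++ Source? W R ⟩
    sources-on + sources-off              ≤⟨ +-mono-≤ on-W off-W ⟩
    (k + sinks-on) + (2 * p + sinks-off)  ≡⟨ interchange +-commutativeSemigroup k sinks-on (2 * p) sinks-off ⟩
    (k + 2 * p) + (sinks-on + sinks-off)  ≡⟨ cong (k + 2 * p +_) (count-∉-++ Sink? W R) ⟨
    k + 2 * p + count (Sink? ∩? ∉-dec R)  ∎
    where
    open ≤-Reasoning
    sources-on  = count ((Source? ∩? ∉-dec R) ∩? ∈-dec W)
    sources-off = count (Source? ∩? ∉-dec (W ++ R))
    sinks-on    = count ((Sink? ∩? ∉-dec R) ∩? ∈-dec W)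
    sinks-off   = count (Sink? ∩? ∉-dec (W ++ R))

  Decomposition-++⁻ : ∀ W {R} (D : Decomposition (W ++ R)) →
    count (Source? ∩? ∉-dec R) ≤ 2 * length (Decomposition.components D) + count (Sink? ∩? ∉-dec R) →
    Decomposition R
  Decomposition-++⁻ W D sources≤′ = record
    { components         = components
    ; disjoint           = disjoint
    ; interiors-disjoint = interiors-disjoint
    ; avoids             = proj₂ ∘ ∉-++⁻ W ∘ avoids
    ; interiors⊆verts    = interiors⊆verts
    ; sources≤           = sources≤′
    }
    where open Decomposition D

  Decomposition-∷ : ∀ {R} (q : Component) → All (_∉ R) (Component.verts q) →
    (D : Decomposition (Component.verts q ++ R)) →
    count (Source? ∩? ∉-dec R) ≤ 2 + 2 * length (Decomposition.components D) + count (Sink? ∩? ∉-dec R) →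
    Decomposition R
  Decomposition-∷ {R} q q-outside D sources≤′ = record
    { components         = q ∷ components
    ; disjoint           = ++⁺ q.distinct disjoint (λ (x∈q , x∈old) → avoids x∈old (∈-++⁺ˡ x∈q))
    ; interiors-disjoint = ++⁺ (Unique-++⁻ˡ q.mid (AllPairs.tail q.distinct)) interiors-disjoint
                               (λ (x∈mid , x∈old) → avoids (interiors⊆verts x∈old) (∈-++⁺ˡ (mid⊆verts x∈mid)))
    ; avoids             = avoids′
    ; interiors⊆verts    = interiors⊆verts′
    ; sources≤           = subst (λ m → count (Source? ∩? ∉-dec R) ≤ m + count (Sink? ∩? ∉-dec R))
                                 (sym (*-suc 2 (length components))) sources≤′
    }
    where
    module q = Component q
    open Decomposition D

    mid⊆verts : q.mid ⊆ q.verts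
    mid⊆verts = there ∘ ∈-++⁺ˡ

    avoids′ : ∀ {x} → x ∈ q.verts ++ concat (map Component.verts components) → x ∉ R
    avoids′ x∈ with ∈-++⁻ q.verts x∈
    ... | inj₁ x∈q   = All.lookup q-outside x∈q
    ... | inj₂ x∈old = proj₂ (∉-++⁻ q.verts (avoids x∈old))

    interiors⊆verts′ : q.mid ++ concat (map Component.mid components) ⊆
                       q.verts ++ concat (map Component.verts components)
    interiors⊆verts′ x∈ with ∈-++⁻ q.mid x∈
    ... | inj₁ x∈mid = ∈-++⁺ˡ (mid⊆verts x∈mid)
    ... | inj₂ x∈old = ∈-++⁺ʳ q.verts (interiors⊆verts x∈old)

  module Walk (v₀ : V) (R : List V) (R-closed : Closed R) (v₀-source : Source v₀) where

    Entered : Bool → V → List V → Set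
    Entered bit c rest = (c ≡ v₀ × bit ≡ true × rest ≡ []) ⊎ (∃ λ y → y ∈ rest × Δ (not bit) c y)

    Parity : Bool → ℕ → Set
    Parity bit len = ∃ λ m → len ≡ (if bit then suc (m + m) else suc (suc (m + m)))

    Parity-suc : ∀ bit {len} → Parity bit len → Parity (not bit) (suc len)
    Parity-suc true  (m , len≡) = m , cong suc len≡
    Parity-suc false (m , len≡) = suc m , cong suc (trans len≡ (cong suc (sym (+-suc m m))))

    Entered-matched : ∀ {bit c rest u} → Entered bit c rest → Δ bit c u → c ≢ v₀ → ∃ (Δ false c)
    Entered-matched (inj₁ (c≡v₀ , _)) _ c≢v₀ = ⊥-elim (c≢v₀ c≡v₀)
    Entered-matched {true}  (inj₂ (z , _ , cz)) _ _ = z , cz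
    Entered-matched {false} {u = u} (inj₂ _) cu _   = u , cu

    -- The walk has reached c after visiting rest (latest first, v₀ last); bit is the colour of the next edge.
    record State (bit : Bool) (c : V) (rest : List V) : Set where
      field
        distinct    : Unique (c ∷ rest)
        saturated   : ∀ {x y} b → x ∈ rest → Δ b x y → y ∈ c ∷ rest
        no-return   : ∀ {x} → x ∈ rest → ¬ Δ bit x c
        entered     : Entered bit c rest
        interior    : ∀ {x} → x ∈ rest → x ≢ v₀ → ∃ (Δ false x)
        ends-at-v₀  : ∃ λ ys → c ∷ rest ≡ ys ++ [ v₀ ]
        parity      : Parity bit (length (c ∷ rest))
        alternating : Alternating (not bit) (c ∷ rest)
        outside     : All (_∉ R) (c ∷ rest)

    initial : v₀ ∉ R → State true v₀ []
    initial v₀∉R = record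
      { distinct    = [] ∷ []
      ; saturated   = λ _ ()
      ; no-return   = λ ()
      ; entered     = inj₁ (refl , refl , refl)
      ; interior    = λ ()
      ; ends-at-v₀  = [] , refl
      ; parity      = 0 , refl
      ; alternating = one v₀
      ; outside     = v₀∉R ∷ []
      }

    other-colour-leads-back : ∀ {bit b c rest y} → State bit c rest → Δ b c y → b ≡ bit ⊎ y ∈ rest
    other-colour-leads-back {true}  {true}  _ _ = inj₁ refl
    other-colour-leads-back {false} {false} _ _ = inj₁ refl
    other-colour-leads-back {true} {false} {rest = rest} s cy with State.entered s
    ... | inj₁ (refl , _)        = ⊥-elim (proj₁ v₀-source _ cy)
    ... | inj₂ (z , z∈rest , cz) = inj₂ (subst (_∈ rest) (Δ-functional false cz cy) z∈rest)
    other-colour-leads-back {false} {true} {rest = rest} s cy with State.entered s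
    ... | inj₂ (z , z∈rest , cz) = inj₂ (subst (_∈ rest) (Δ-functional true cz cy) z∈rest)

    module _ {bit c rest u} (s : State bit c rest) (cu : Δ bit c u) where
      open State s

      next∉walk : u ∉ c ∷ rest
      next∉walk (here refl)    = Δ-irreflexive bit cu
      next∉walk (there u∈rest) = no-return u∈rest (Δ-sym bit cu)

      next-saturated : ∀ {x y} b → x ∈ c ∷ rest → Δ b x y → y ∈ u ∷ c ∷ rest
      next-saturated b (there x∈rest) xy = there (saturated b x∈rest xy)
      next-saturated b (here refl) cy with other-colour-leads-back s cy
      ... | inj₁ refl    = here (Δ-functional bit cy cu)
      ... | inj₂ y∈rest  = there (there y∈rest)

      next-no-return : ∀ {x} → x ∈ c ∷ rest → ¬ Δ (not bit) x u
      next-no-return (here refl)    = Δ-disjoint bit cu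
      next-no-return (there x∈rest) xu = next∉walk (saturated (not bit) x∈rest xu)

      next-entered : Entered (not bit) u (c ∷ rest)
      next-entered = inj₂ (c , here refl , subst (λ b → Δ b u c) (sym (not-involutive bit)) (Δ-sym bit cu))

      next-interior : ∀ {x} → x ∈ c ∷ rest → x ≢ v₀ → ∃ (Δ false x)
      next-interior (there x∈rest) x≢v₀ = interior x∈rest x≢v₀
      next-interior (here refl)    c≢v₀ = Entered-matched entered cu c≢v₀

      extend : State (not bit) u (c ∷ rest)
      extend = record
        { distinct    = ¬Any⇒All¬ _ next∉walk ∷ distinct
        ; saturated   = next-saturated
        ; no-return   = next-no-return
        ; entered     = next-entered
        ; interior    = next-interior
        ; ends-at-v₀  = let ys , walk≡ = ends-at-v₀ in u ∷ ys , cong (u ∷_) walk≡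
        ; parity      = Parity-suc bit parity
        ; alternating = Alternating-∷ (Δ-sym bit cu) alternating
        ; outside     = R-closed (All.head outside) cu ∷ outside
        }

    record Stuck : Set where
      field
        {colour}  : Bool
        {current} : V
        {visited} : List V
        state     : State colour current visited
        stuck     : ∀ u → ¬ Δ colour current u

    walk : ∀ {bit c rest} fuel → State bit c rest → n < length (c ∷ rest) + fuel → Stuck
    walk {bit} {c} fuel s n<len with any? (Δ? bit c)
    ... | no ¬next = record { state = s ; stuck = λ u cu → ¬next (u , cu) }
    walk zero s n<len | yes _ =
      ⊥-elim (<⇒≱ (subst (n <_) (+-identityʳ _) n<len) (Unique⇒length≤n (State.distinct s)))
    walk (suc fuel) s n<len | yes (u , cu) = walk fuel (extend s cu) (subst (n <_) (+-suc _ fuel) n<len)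

    module _ {bit c rest} (s : State bit c rest) (stuck : ∀ u → ¬ Δ bit c u) where
      open State s

      walk-saturated : ∀ {b x y} → x ∈ c ∷ rest → Δ b x y → y ∈ c ∷ rest
      walk-saturated (there x∈rest) xy = saturated _ x∈rest xy
      walk-saturated (here refl) cy with other-colour-leads-back s cy
      ... | inj₁ refl   = ⊥-elim (stuck _ cy)
      ... | inj₂ y∈rest = there y∈rest

      walk++R-closed : Closed (c ∷ rest ++ R)
      walk++R-closed {b} x∉ xy y∈ with ∈-++⁻ (c ∷ rest) y∈
      ... | inj₁ y∈walk = x∉ (∈-++⁺ˡ (walk-saturated y∈walk (Δ-sym b xy)))
      ... | inj₂ y∈R    = R-closed (proj₂ (∉-++⁻ (c ∷ rest) x∉)) xy y∈R

      v₀∈walk : v₀ ∈ c ∷ rest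
      v₀∈walk = let ys , walk≡ = ends-at-v₀ in subst (v₀ ∈_) (sym walk≡) (∈-++⁺ʳ ys (here refl))

      walk++R-shrinks : count (∉-dec (c ∷ rest ++ R)) < count (∉-dec R)
      walk++R-shrinks = begin-strict
        count (∉-dec (c ∷ rest ++ R))
          ≤⟨ count-mono (∉-dec (c ∷ rest ++ R)) (∉-dec R ∩? ∁? (∈-dec (c ∷ rest)))
                        (λ v∉ → let v∉walk , v∉R = ∉-++⁻ (c ∷ rest) v∉ in v∉R , v∉walk) ⟩
        count (∉-dec R ∩? ∁? (∈-dec (c ∷ rest)))
          <⟨ m<n+m _ (length≤count (∉-dec R ∩? ∈-dec (c ∷ rest)) ([] ∷ [])
                                   ((All.lookup outside v₀∈walk , v₀∈walk) ∷ [])) ⟩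
        count (∉-dec R ∩? ∈-dec (c ∷ rest)) + count (∉-dec R ∩? ∁? (∈-dec (c ∷ rest)))
          ≡⟨ count-split (∉-dec R) (∈-dec (c ∷ rest)) ⟨
        count (∉-dec R) ∎
        where open ≤-Reasoning

      source-on-walk : ∀ {z} → z ∈ rest → Source z → z ≡ v₀
      source-on-walk {z} z∈rest (no-false , _) with z ≟ v₀
      ... | yes z≡v₀ = z≡v₀
      ... | no z≢v₀  = ⊥-elim (no-false _ (proj₂ (interior z∈rest z≢v₀)))

    sink-end : ∀ {c rest} → State true c rest → (∀ u → ¬ Δ true c u) →
               Decomposition (c ∷ rest ++ R) → Decomposition R
    sink-end {c} {rest} s stuck D =
      Decomposition-++⁻ (c ∷ rest) D
        (sources≤-++ (c ∷ rest) 0 (length D.components) (≤-trans sources-on-walk sinks-on-walk) D.sources≤)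
      where
      module D = Decomposition D
      open State s using (entered; outside)

      c-sink : Sink c
      c-sink with entered
      ... | inj₁ (refl , _)   = ⊥-elim (stuck _ (proj₂ (proj₂ v₀-source)))
      ... | inj₂ (z , _ , cz) = stuck , z , cz

      sources-on-walk : count ((Source? ∩? ∉-dec R) ∩? ∈-dec (c ∷ rest)) ≤ 1
      sources-on-walk = count≤length ((Source? ∩? ∉-dec R) ∩? ∈-dec (c ∷ rest)) {ys = [ v₀ ]} λ where
        ((z-source , _) , here refl)    → ⊥-elim (stuck _ (proj₂ (proj₂ z-source)))
        ((z-source , _) , there z∈rest) → here (source-on-walk s stuck z∈rest z-source)

      sinks-on-walk : 1 ≤ count ((Sink? ∩? ∉-dec R) ∩? ∈-dec (c ∷ rest))
      sinks-on-walk = length≤count ((Sink? ∩? ∉-dec R) ∩? ∈-dec (c ∷ rest)) ([] ∷ [])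
                                   (((c-sink , All.head outside) , here refl) ∷ [])

    component-at-source-end : ∀ {c mid} → State false c (mid ++ [ v₀ ]) → (∀ u → ¬ Δ false c u) → Component
    component-at-source-end {c} {mid} s stuck = record
      { start        = c
      ; end          = v₀
      ; mid          = mid
      ; half         = proj₁ parity
      ; distinct     = distinct
      ; alternating  = alternating
      ; start-source = c-source
      ; end-source   = v₀-source
      ; mid-even     = mid-even
      ; mid-matched  = λ x∈mid → interior (∈-++⁺ˡ x∈mid)
                         (λ { refl → Unique-++⇒disjoint mid (AllPairs.tail distinct) x∈mid (here refl) })
      }
      where
      open State s using (distinct; entered; interior; parity; alternating)

      c-source : Source c
      c-source with entered
      ... | inj₂ (z , _ , cz) = stuck , z , cz

      mid-even : length mid ≡ proj₁ parity + proj₁ parity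
      mid-even = suc-injective (begin
        suc (length mid)                   ≡⟨ +-comm 1 (length mid) ⟩
        length mid + length [ v₀ ]         ≡⟨ length-++ mid ⟨
        length (mid ++ [ v₀ ])             ≡⟨ suc-injective (proj₂ parity) ⟩
        suc (proj₁ parity + proj₁ parity)  ∎)
        where open ≡-Reasoning

    source-end : ∀ {c mid} → State false c (mid ++ [ v₀ ]) → (∀ u → ¬ Δ false c u) →
                 Decomposition (c ∷ (mid ++ [ v₀ ]) ++ R) → Decomposition R
    source-end {c} {mid} s stuck D =
      Decomposition-∷ (component-at-source-end s stuck) (State.outside s) D
        (sources≤-++ (c ∷ mid ++ [ v₀ ]) 2 (length D.components)
                     (≤-trans sources-on-walk (m≤m+n 2 _)) D.sources≤)
      where
      module D = Decomposition D
      sources-on-walk : count ((Source? ∩? ∉-dec R) ∩? ∈-dec (c ∷ mid ++ [ v₀ ])) ≤ 2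
      sources-on-walk = count≤length ((Source? ∩? ∉-dec R) ∩? ∈-dec (c ∷ mid ++ [ v₀ ])) {ys = c ∷ v₀ ∷ []}
        λ where
        (_ , here refl)                  → here refl
        ((z-source , _) , there z∈rest) → there (here (source-on-walk s stuck z∈rest z-source))

    rest-ends-at-v₀ : ∀ {c rest} → State false c rest → ∃ λ mid → rest ≡ mid ++ [ v₀ ]
    rest-ends-at-v₀ s with State.ends-at-v₀ s | State.entered s
    ... | [] , refl       | inj₂ (_ , () , _)
    ... | _ ∷ mid , walk≡ | _ = mid , ∷-injectiveʳ walk≡

  decompose : ∀ fuel R → Closed R → count (∉-dec R) ≤ fuel → Decomposition R
  decompose fuel R R-closed R≤fuel with any? (Source? ∩? ∉-dec R)
  ... | no no-source = record
    { components         = []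
    ; disjoint           = []
    ; interiors-disjoint = []
    ; avoids             = λ ()
    ; interiors⊆verts    = λ ()
    ; sources≤           = ≤-trans (count≤length (Source? ∩? ∉-dec R) {ys = []} (λ {v} v∈ → ⊥-elim (no-source (v , v∈))))
                                   z≤n
    }
  decompose zero R _ R≤0 | yes (_ , _ , v∉R) =
    ⊥-elim (<⇒≱ (length≤count (∉-dec R) ([] ∷ []) (v∉R ∷ [])) R≤0)
  decompose (suc fuel) R R-closed R≤fuel | yes (v₀ , v₀-source , v₀∉R) =
    finish (walk n (initial v₀∉R) ≤-refl)
    where
    open Walk v₀ R R-closed v₀-source

    rest-decomposition : ∀ {bit c rest} (s : State bit c rest) (stuck : ∀ u → ¬ Δ bit c u) →
                         Decomposition (c ∷ rest ++ R)
    rest-decomposition s stuck =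
      decompose fuel _ (walk++R-closed s stuck) (≤-pred (≤-trans (walk++R-shrinks s stuck) R≤fuel))

    finish : Stuck → Decomposition R
    finish record { colour = true ; state = s ; stuck = stuck } = sink-end s stuck (rest-decomposition s stuck)
    finish record { colour = false ; state = s ; stuck = stuck } with rest-ends-at-v₀ s
    ... | _ , refl = source-end s stuck (rest-decomposition s stuck)

  decomposition : Decomposition []
  decomposition = decompose n [] (λ _ _ ()) (count≤n (∉-dec []))

  open Decomposition decomposition public using (components; disjoint; interiors-disjoint)

  private
    no-sinks⇒count≡0 : (∀ {v} → ¬ Sink v) → count (Sink? ∩? ∉-dec []) ≡ 0
    no-sinks⇒count≡0 no-sink =
      n≤0⇒n≡0 (count≤length (Sink? ∩? ∉-dec []) {ys = []} (⊥-elim ∘ no-sink ∘ proj₁))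

  distinct-sources≤ : ∀ {ys} → Unique ys → All Source ys → (∀ {v} → ¬ Sink v) →
                      length ys ≤ 2 * length components
  distinct-sources≤ {ys} unique sources no-sink = begin
    length ys                                          ≤⟨ length≤count (Source? ∩? ∉-dec []) unique
                                                                       (All.map (_, λ ()) sources) ⟩
    count (Source? ∩? ∉-dec [])                        ≤⟨ Decomposition.sources≤ decomposition ⟩
    2 * length components + count (Sink? ∩? ∉-dec [])  ≡⟨ cong (2 * length components +_) (no-sinks⇒count≡0 no-sink) ⟩
    2 * length components + 0                          ≡⟨ +-identityʳ _ ⟩
    2 * length components                              ∎
    where open ≤-Reasoning

  N-covered≤ : count (Covered? N.decidable) ≤ count (Covered? M.decidable) + 2 * length components
  N-covered≤ = begin
    count N?                                    ≡⟨ count-split N? M? ⟩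
    count (N? ∩? M?) + count (N? ∩? ∁? M?)
      ≤⟨ +-mono-≤ (count-mono (N? ∩? M?) (M? ∩? N?) swap)
                  (count-mono (N? ∩? ∁? M?) (Source? ∩? ∉-dec [])
                     (λ ((y , vy) , ¬M-covered) → free⇒Source (λ w vw → ¬M-covered (w , vw)) vy , λ ())) ⟩
    count (M? ∩? N?) + count (Source? ∩? ∉-dec [])
      ≤⟨ +-monoʳ-≤ (count (M? ∩? N?)) (Decomposition.sources≤ decomposition) ⟩
    count (M? ∩? N?) + (2 * length components + count (Sink? ∩? ∉-dec []))
      ≤⟨ +-monoʳ-≤ (count (M? ∩? N?)) (+-monoʳ-≤ (2 * length components)
           (count-mono (Sink? ∩? ∉-dec []) (M? ∩? ∁? N?)
              (λ (v-sink@(_ , w , vw , _) , _) → (w , vw) , λ (y , vy) → Sink⇒N-free v-sink vy))) ⟩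
    count (M? ∩? N?) + (2 * length components + count (M? ∩? ∁? N?))
      ≡⟨ cong (count (M? ∩? N?) +_) (+-comm (2 * length components) (count (M? ∩? ∁? N?))) ⟩
    count (M? ∩? N?) + (count (M? ∩? ∁? N?) + 2 * length components)
      ≡⟨ +-assoc (count (M? ∩? N?)) _ _ ⟨
    count (M? ∩? N?) + count (M? ∩? ∁? N?) + 2 * length components
      ≡⟨ cong (_+ 2 * length components) (count-split M? N?) ⟨
    count M? + 2 * length components            ∎
    where
    open ≤-Reasoning
    M? = Covered? M.decidable
    N? = Covered? N.decidable

  Alternating-edge : ∀ {bit vs} → Alternating bit vs → x ∈ vs → (∃ λ b → ∃ (Δ b x)) ⊎ vs ≡ [ x ]
  Alternating-edge (one v) (here refl) = inj₂ refl
  Alternating-edge (cons u v vs uv _) (here refl) = inj₁ (_ , v , uv)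
  Alternating-edge (cons u v vs uv alt) (there x∈tail) with Alternating-edge alt x∈tail
  ... | inj₁ edge = inj₁ edge
  ... | inj₂ refl = inj₁ (_ , u , Δ-sym _ uv)

  component-edge : (q : Component) → x ∈ Component.verts q → ∃ λ b → ∃ (Δ b x)
  component-edge q x∈q with Alternating-edge (Component.alternating q) x∈q
  ... | inj₁ edge   = edge
  ... | inj₂ verts≡ = contradiction (++-conicalʳ (Component.mid q) _ (∷-injectiveʳ verts≡)) λ ()

  module _ {G : List (Edge n)} (M⊆G : ∀ {u v} → Adj M u v → Adj G u v) (N⊆G : ∀ {u v} → N u v → Adj G u v)
    where

    Alternating⇒Alt : ∀ {bit vs} → Alternating bit vs → Alt G M bit vs
    Alternating⇒Alt (one v) = one v
    Alternating⇒Alt {true}  (cons u v vs (uv , ¬Muv) alt) = cons u v vs (N⊆G uv) ¬Muv (Alternating⇒Alt alt)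
    Alternating⇒Alt {false} (cons u v vs (Muv , _) alt)   = cons u v vs (M⊆G Muv) Muv (Alternating⇒Alt alt)

    component⇒AugPath : Component → AugPath G M
    component⇒AugPath q = record
      { start     = start
      ; mid       = mid
      ; end       = end
      ; distinct  = distinct
      ; alt       = Alternating⇒Alt alternating
      ; startFree = Source⇒free start-source
      ; endFree   = Source⇒free end-source
      }
      where open Component q

-- One augmentation step

module AugmentStep {k : ℕ} {G M M′ : List (Edge n)} {a b : Fin n}
  (loopFree    : LoopFree ((a , b) ∷ G))
  (M-matching  : IsMatching ((a , b) ∷ G) M)
  (long        : LongAugPaths k G M)
  (P           : AugPath ((a , b) ∷ G) M)
  (P<k         : pathLength P + 1 ≤ k)
  (P-shortest  : ∀ (Q : AugPath ((a , b) ∷ G) M) → Contains Q (a , b) → pathLength P ≤ pathLength Q)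
  (M′-matching : IsMatching ((a , b) ∷ G) M′)
  (M′≡M⊕P      : ∀ u v → Adj M′ u v ⇔ Xor (Adj M u v) (PathAdj (AugPath.verts P) u v))
  where

  private
    G₁ = (a , b) ∷ G
    M-rel  = Adj-isMatchingRel loopFree M-matching
    M′-rel = Adj-isMatchingRel loopFree M′-matching
    module P = AugmentingPath M-rel P

    M⊕P⇒M′ : P.Augmented u v → Adj M′ u v
    M⊕P⇒M′ = Equivalence.from (M′≡M⊕P _ _)

    M′⇒M⊕P : Adj M′ u v → P.Augmented u v
    M′⇒M⊕P = Equivalence.to (M′≡M⊕P _ _)

    M′-free⇒M-free : Free M′ v → Free M v
    M′-free⇒M-free v-free w vw = let y , vy = P.augmented-covers-matched vw in v-free y (M⊕P⇒M′ vy)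

    P-vertex-M′-covered : v ∈ P.verts → Covered (Adj M′) v
    P-vertex-M′-covered v∈P = let y , vy = P.augmented-covers-path v∈P in y , M⊕P⇒M′ vy

    long-or-through-e : (Q : AugPath G₁ M) →
                        k ≤ pathLength Q ⊎ (Contains Q (a , b) × pathLength P ≤ pathLength Q)
    long-or-through-e Q with through-or-long long Q
    ... | inj₁ Q∋ab = inj₂ (Q∋ab , P-shortest Q Q∋ab)
    ... | inj₂ k≤Q  = inj₁ k≤Q

  module _ (Q : AugPath G₁ M′) where
    private
      module Q = AugmentingPath M′-rel Q
      -- In M ⊕ (M′ ⊕ Q) there are no sinks, and the ends of P and of Q are four distinct sources.
      open SymmetricDifference M-rel (Q.augmented-isMatchingRel loopFree)

      no-sink : ¬ Sink v
      no-sink v-sink@(_ , w , vw , _) =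
        let y , vy = P.augmented-covers-matched vw
            z , vz = Q.augmented-covers-matched (M⊕P⇒M′ vy)
        in Sink⇒N-free v-sink vz

      P-end-source : Free M v → v ∈ P.verts → Source v
      P-end-source v-free v∈P = let y , vy = P-vertex-M′-covered v∈P in
        free⇒Source v-free (proj₂ (Q.augmented-covers-matched vy))

      Q-end-source : Free M′ v → v ∈ Q.verts → Source v
      Q-end-source v-free v∈Q = free⇒Source (M′-free⇒M-free v-free) (proj₂ (Q.augmented-covers-path v∈Q))

      P-vertex≢Q-end : v ∈ P.verts → Free M′ w → v ≢ w
      P-vertex≢Q-end v∈P w-free refl = let y , vy = P-vertex-M′-covered v∈P in w-free y vy

      path-ends : List (Fin n)
      path-ends = P.start ∷ P.end ∷ Q.start ∷ Q.end ∷ []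

      path-ends-distinct : Unique path-ends
      path-ends-distinct =
          (P.start≢end ∷ P-vertex≢Q-end (here refl) Q.startFree ∷ P-vertex≢Q-end (here refl) Q.endFree ∷ [])
        ∷ (P-vertex≢Q-end P.end∈verts Q.startFree ∷ P-vertex≢Q-end P.end∈verts Q.endFree ∷ [])
        ∷ (Q.start≢end ∷ [])
        ∷ [] ∷ []

      path-ends-sources : All Source path-ends
      path-ends-sources = P-end-source P.startFree (here refl) ∷ P-end-source P.endFree P.end∈verts
                        ∷ Q-end-source Q.startFree (here refl) ∷ Q-end-source Q.endFree Q.end∈verts ∷ []

      component-vertex∈P++Q : (q : Component) → x ∈ Component.verts q → x ∈ P.verts ++ Q.verts
      component-vertex∈P++Q q x∈q with component-edge q x∈q
      ... | bit , y , xy with Adj? (pathEdges P.verts) _ y | Adj? (pathEdges Q.verts) _ y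
      ... | yes xy-on-P | _           = ∈-++⁺ˡ (PathAdj⇒∈ P.verts xy-on-P)
      ... | no _        | yes xy-on-Q = ∈-++⁺ʳ P.verts (PathAdj⇒∈ Q.verts xy-on-Q)
      ... | no ¬xy-on-P | no ¬xy-on-Q = ⊥-elim (off-P-and-Q bit xy)
        where
        off-P-and-Q : ∀ bit → ¬ Δ bit _ y
        off-P-and-Q true  (inj₁ (M′xy , _) , ¬Mxy) with M′⇒M⊕P M′xy
        ... | inj₁ (Mxy , _)     = ¬Mxy Mxy
        ... | inj₂ (_ , xy-on-P) = ¬xy-on-P xy-on-P
        off-P-and-Q true  (inj₂ (_ , xy-on-Q) , _) = ¬xy-on-Q xy-on-Q
        off-P-and-Q false (Mxy , ¬Nxy) = ¬Nxy (inj₁ (M⊕P⇒M′ (inj₁ (Mxy , ¬xy-on-P)) , ¬xy-on-Q))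

      N⊆G₁ : Q.Augmented u v → Adj G₁ u v
      N⊆G₁ (inj₁ (M′uv , _))     = matching⊆graph M′-matching M′uv
      N⊆G₁ (inj₂ (_ , uv-on-Q)) = Alt⇒graph Q.alt uv-on-Q

      asAugPath : Component → AugPath G₁ M
      asAugPath = component⇒AugPath (matching⊆graph M-matching) N⊆G₁

      module _ (q₁ q₂ : Component) (disjoint-pair : Unique (Component.verts q₁ ++ Component.verts q₂)) where
        p₁ = pathLength (asAugPath q₁)
        p₂ = pathLength (asAugPath q₂)

        pair-through-e-bound : pathLength P + k ≤ p₁ + p₂
        pair-through-e-bound with long-or-through-e (asAugPath q₁) | long-or-through-e (asAugPath q₂)
        ... | inj₁ k≤p₁ | inj₁ k≤p₂ = +-mono-≤ (≤-trans (m+n≤o⇒m≤o (pathLength P) P<k) k≤p₁) k≤p₂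
        ... | inj₁ k≤p₁ | inj₂ (_ , P≤p₂) = ≤-trans (≤-reflexive (+-comm (pathLength P) k)) (+-mono-≤ k≤p₁ P≤p₂)
        ... | inj₂ (_ , P≤p₁) | inj₁ k≤p₂ = +-mono-≤ P≤p₁ k≤p₂
        ... | inj₂ (q₁∋ab , _) | inj₂ (q₂∋ab , _) =
          ⊥-elim (Unique-++⇒disjoint (Component.verts q₁) disjoint-pair
                                     (PathAdj⇒∈ _ q₁∋ab) (PathAdj⇒∈ _ q₂∋ab))

        pair-within-P∪Q : p₁ + p₂ ≤ pathLength P + pathLength Q
        pair-within-P∪Q = ≤-pred (≤-pred (begin
          suc (suc (p₁ + p₂))                                       ≡⟨ cong suc (+-suc p₁ p₂) ⟨
          suc p₁ + suc p₂                                           ≡⟨ cong₂ _+_ (length-verts (asAugPath q₁))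
                                                                                 (length-verts (asAugPath q₂)) ⟨
          length (Component.verts q₁) + length (Component.verts q₂) ≡⟨ length-++ (Component.verts q₁) ⟨
          length (Component.verts q₁ ++ Component.verts q₂)
            ≤⟨ Unique-⊆⇒length≤ disjoint-pair (λ x∈ → [ component-vertex∈P++Q q₁ , component-vertex∈P++Q q₂ ]′
                                                        (∈-++⁻ (Component.verts q₁) x∈)) ⟩
          length (P.verts ++ Q.verts)                               ≡⟨ length-++ P.verts ⟩
          length P.verts + length Q.verts                           ≡⟨ cong₂ _+_ (length-verts P) (length-verts Q) ⟩
          suc (pathLength P) + suc (pathLength Q)                   ≡⟨ cong suc (+-suc (pathLength P) (pathLength Q)) ⟩
          suc (suc (pathLength P + pathLength Q))                   ∎))
          where open ≤-Reasoning

      many-components-bound : ∀ qs → Unique (concat (map Component.verts qs)) → 4 ≤ 2 * length qs →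
                              k ≤ pathLength Q
      many-components-bound []          _ ()
      many-components-bound (_ ∷ [])    _ (s≤s (s≤s ()))
      many-components-bound (q₁ ∷ q₂ ∷ qs) uniq _ =
        +-cancelˡ-≤ (pathLength P) _ _
          (≤-trans (pair-through-e-bound q₁ q₂ disjoint-pair) (pair-within-P∪Q q₁ q₂ disjoint-pair))
        where
        disjoint-pair : Unique (Component.verts q₁ ++ Component.verts q₂)
        disjoint-pair = Unique-++⁻ˡ (Component.verts q₁ ++ Component.verts q₂)
          (subst Unique (sym (++-assoc (Component.verts q₁) (Component.verts q₂) _)) uniq)

    M′-long : k ≤ pathLength Q
    M′-long = many-components-bound components disjoint
                   (distinct-sources≤ path-ends-distinct path-ends-sources no-sink)

-- The competitive ratio

module _ {k : ℕ} {G M M* : List (Edge n)} (k-even : Even k) (loopFree : LoopFree G)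
  (M-matching : IsMatching G M) (long : LongAugPaths k G M) (M*-matching : IsMatching G M*) where

  private
    open SymmetricDifference (Adj-isMatchingRel loopFree M-matching) (Adj-isMatchingRel loopFree M*-matching)

    interior-long : (q : Component) → k ≤ length (Component.mid q)
    interior-long q = subst₂ _≤_ (sym k≡h+h) (sym mid-even) (+-mono-≤ h≤half h≤half)
      where
      open Component q
      h = proj₁ k-even
      k≡h+h = proj₂ k-even
      augPath = component⇒AugPath (matching⊆graph M-matching) (matching⊆graph M*-matching) q
      h≤half : h ≤ half
      h≤half = double≤suc-double⇒≤ h half
        (subst₂ _≤_ k≡h+h (trans (pathLength≡suc-mid augPath) (cong suc mid-even)) (long augPath))

    interiors-long : ∀ qs → k * length qs ≤ length (concat (map Component.mid qs))
    interiors-long []       = ≤-reflexive (*-zeroʳ k)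
    interiors-long (q ∷ qs) = begin
      k * suc (length qs)                                          ≡⟨ *-suc k (length qs) ⟩
      k + k * length qs                                            ≤⟨ +-mono-≤ (interior-long q) (interiors-long qs) ⟩
      length (Component.mid q) + length (concat (map Component.mid qs)) ≡⟨ length-++ (Component.mid q) ⟨
      length (concat (map Component.mid (q ∷ qs)))                 ∎
      where open ≤-Reasoning

    interiors-covered : ∀ qs → All (Covered (Adj M)) (concat (map Component.mid qs))
    interiors-covered []       = []
    interiors-covered (q ∷ qs) =
      All-++⁺ (All.tabulate (λ x∈mid → let y , xy , _ = Component.mid-matched q x∈mid in y , xy))
              (interiors-covered qs)

    M*≤M+components : length M* ≤ length M + length components
    M*≤M+components = *-cancelˡ-≤ 2 (begin
      2 * length M*                                        ≤⟨ matching-count-covered loopFree M*-matching ⟩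
      count (Covered? (Adj? M*))                           ≤⟨ N-covered≤ ⟩
      count (Covered? (Adj? M)) + 2 * length components    ≤⟨ +-monoˡ-≤ (2 * length components) (count-covered≤ M) ⟩
      2 * length M + 2 * length components                 ≡⟨ *-distribˡ-+ 2 (length M) (length components) ⟨
      2 * (length M + length components)                   ∎)
      where open ≤-Reasoning

    k*components≤2M : k * length components ≤ 2 * length M
    k*components≤2M = begin
      k * length components                                ≤⟨ interiors-long components ⟩
      length (concat (map Component.mid components))       ≤⟨ length≤count (Covered? (Adj? M)) interiors-disjoint
                                                                (interiors-covered components) ⟩
      count (Covered? (Adj? M))                            ≤⟨ count-covered≤ M ⟩
      2 * length M                                         ∎
      where open ≤-Reasoning

  long-augPaths⇒competitive : k * length M* ≤ (k + 2) * length M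
  long-augPaths⇒competitive = begin
    k * length M*                          ≤⟨ *-monoʳ-≤ k M*≤M+components ⟩
    k * (length M + length components)     ≡⟨ *-distribˡ-+ k (length M) (length components) ⟩
    k * length M + k * length components   ≤⟨ +-monoʳ-≤ (k * length M) k*components≤2M ⟩
    k * length M + 2 * length M            ≡⟨ *-distribʳ-+ (length M) k 2 ⟨
    (k + 2) * length M                     ∎
    where open ≤-Reasoning

-- The invariant along a run

module _ {k : ℕ} where

  step-invariant : ∀ {G M M′} → LoopFree ((a , b) ∷ G) → IsMatching G M → LongAugPaths k G M →
                   Step k ((a , b) ∷ G) M (a , b) M′ →
                   IsMatching ((a , b) ∷ G) M′ × LongAugPaths k ((a , b) ∷ G) M′
  step-invariant loopFree M-matching long (keep no-short-through-e) =
    IsMatching-mono there M-matching , λ Q → [ no-short-through-e Q , id ]′ (through-or-long long Q)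
  step-invariant loopFree M-matching long (augment P _ P<k P-shortest M′ M′-matching M′≡M⊕P) =
    M′-matching ,
    AugmentStep.M′-long loopFree (IsMatching-mono there M-matching) long P P<k P-shortest M′-matching M′≡M⊕P

  run-invariant : ∀ {G M es Mf : List (Edge n)} → Run k G M es Mf →
                  LoopFree (es ʳ++ G) → IsMatching G M → LongAugPaths k G M →
                  IsMatching (es ʳ++ G) Mf × LongAugPaths k (es ʳ++ G) Mf
  run-invariant done _ M-matching long = M-matching , long
  run-invariant {es = e ∷ es} (step s run) loopFree M-matching long =
    let M′-matching , M′-long = step-invariant (loopFree ∘ Adj-mono (∈-ʳ++⁺ʳ es)) M-matching long s
    in run-invariant run loopFree M′-matching M′-long

theorem5 : (k : ℕ) → 0 < k → Even k →
    ∃ λ (c : ℕ) → ∀ (n : ℕ) (es : List (Edge n)) → SimpleSeq es →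
      ∀ (Mf : List (Edge n)) → Run k [] [] es Mf →
      ∀ (Mopt : List (Edge n)) → IsMatching es Mopt →
      k * length Mopt ≤ (k + 2) * (length Mf + c)
theorem5 k _ k-even = 0 , λ n es simple Mf run Mopt Mopt-matching →
  let loopFree : LoopFree (es ʳ++ [])
      loopFree = nonLoops⇒LoopFree (proj₁ simple) ∘ Adj-mono (λ e∈ → [ id , (λ ()) ]′ (∈-ʳ++⁻ es e∈))
      Mf-matching , Mf-long = run-invariant run loopFree ([] , []) (⊥-elim ∘ no-augPath-in-empty)
  in subst (k * length Mopt ≤_) (cong ((k + 2) *_) (sym (+-identityʳ (length Mf))))
       (long-augPaths⇒competitive k-even loopFree Mf-matching Mf-long (IsMatching-mono (∈-ʳ++⁺ˡ es) Mopt-matching))
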